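{- The universe $\mathcal D$ of dicot games has the conjugate property: for all $G,H\in\mathcal D$, if $G+H\equiv_{\mathcal D}\mathbf 0$ then $H\equiv_{\mathcal D}\overline G$.
   Context: All games are short two-player partizan games between Left and Right, identified with their game trees: $G=\{G^{\mathcal L}\mid G^{\mathcal R}\}$ with finite sets of options; $\mathbf 0=\{\;\mid\;\}$. Followers of $G$: $G$, its options, their options, etc. Disjunctive sum: $G+H=\{G^{\mathcal L}+H,G+H^{\mathcal L}\mid G^{\mathcal R}+H,G+H^{\mathcal R}\}$. Conjugate: $\overline G=\{\overline{G^{\mathcal R}}\mid\overline{G^{\mathcal L}}\}$. Misère play: a player with no move on their turn wins. $o_L(G)=\mathrm L$ if $G^{\mathcal L}=\emptyset$, else $\max_{G^L}o_R(G^L)$; $o_R(G)=\mathrm R$ if $G^{\mathcal R}=\emptyset$, else $\min_{G^R}o_L(G^R)$; $\mathrm L>\mathrm R$; $o(G)=(o_L(G),o_R(G))$ ordered componentwise. A game is a dicot if for each follower either both players have a move or neither does; $\mathcal D$ is the class of dicots. $G\geq_{\mathcal D}H$ means $o(G+X)\geq o(H+X)$ for all $X\in\mathcal D$; $\equiv_{\mathcal D}$ means both directions. -}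

module Defs where

open import Data.List using (List; []; _∷_)
open import Data.List.Relation.Unary.All using (All)
open import Data.Product using (_×_)

-- Short partizan games as game trees with finite (listed) option sets.
data Game : Set where
  ⟨_∣_⟩ : List Game → List Game → Game

leftOpts : Game → List Game
leftOpts ⟨ l ∣ r ⟩ = l

rightOpts : Game → List Game
rightOpts ⟨ l ∣ r ⟩ = r

zeroG : Game
zeroG = ⟨ [] ∣ [] ⟩

-- Misère outcomes: L > R
data Result : Set where
  L R : Result

data _≤ᴿ_ : Result → Result → Set where
  R≤R : R ≤ᴿ R
  R≤L : R ≤ᴿ L
  L≤L : L ≤ᴿ L

maxR : Result → Result → Result
maxR L _ = L
maxR R y = y

minR : Result → Result → Result
minR R _ = R
minR L y = y

mutual
  oL : Game → Result
  oL ⟨ [] ∣ r ⟩ = L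
  oL ⟨ g ∷ gs ∣ r ⟩ = maxOR g gs

  oR : Game → Result
  oR ⟨ l ∣ [] ⟩ = R
  oR ⟨ l ∣ g ∷ gs ⟩ = minOL g gs

  maxOR : Game → List Game → Result
  maxOR g [] = oR g
  maxOR g (h ∷ hs) = maxR (oR g) (maxOR h hs)

  minOL : Game → List Game → Result
  minOL g [] = oL g
  minOL g (h ∷ hs) = minR (oL g) (minOL h hs)

_≥ₒ_ : Game → Game → Set
G ≥ₒ H = (oL H ≤ᴿ oL G) × (oR H ≤ᴿ oR G)

mutual
  _+G_ : Game → Game → Game
  ⟨ gl ∣ gr ⟩ +G ⟨ hl ∣ hr ⟩ =
    ⟨ appendL (addR gl ⟨ hl ∣ hr ⟩) (addL ⟨ gl ∣ gr ⟩ hl)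
    ∣ appendL (addR gr ⟨ hl ∣ hr ⟩) (addL ⟨ gl ∣ gr ⟩ hr) ⟩

  addR : List Game → Game → List Game
  addR [] h = []
  addR (g ∷ gs) h = (g +G h) ∷ addR gs h

  addL : Game → List Game → List Game
  addL g [] = []
  addL g (h ∷ hs) = (g +G h) ∷ addL g hs

  appendL : List Game → List Game → List Game
  appendL [] ys = ys
  appendL (x ∷ xs) ys = x ∷ appendL xs ys

mutual
  conj : Game → Game
  conj ⟨ l ∣ r ⟩ = ⟨ conjList r ∣ conjList l ⟩

  conjList : List Game → List Game
  conjList [] = []
  conjList (g ∷ gs) = conj g ∷ conjList gs

data IsDicot : Game → Set where
  dicot-zero : IsDicot ⟨ [] ∣ [] ⟩
  dicot-cons : ∀ gl gls gr grs →
    All IsDicot (gl ∷ gls) → All IsDicot (gr ∷ grs) →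
    IsDicot ⟨ gl ∷ gls ∣ gr ∷ grs ⟩

_≥D_ : Game → Game → Set
G ≥D H = ∀ X → IsDicot X → (G +G X) ≥ₒ (H +G X)

_≡D_ : Game → Game → Set
G ≡D H = (G ≥D H) × (H ≥D G)

module Submission where

-- The heart is the main lemma sum≥D0⇒≥D-conj: for dicots A, B, A + B ≥D 0
-- implies B ≥D Ā.  It is proved by induction on the heights, via
--  * a sufficient "maintenance" condition for A ≥D B (Maintains, maintains⇒≥D),
--    proved by induction on the distinguishing dicot X;
--  * the fact that if A ≥D 0 then each right option A^R has a left option
--    A^{RL} ≥D 0 (rightOpt-reply).  This is shown classically: otherwise each
--    A^{RL} has a "spoiler", and the spoilers, together with the misère adjoint
--    (A^R)° (for which A^R + (A^R)° is a P-position), build a dicot X on which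
--    A + X is worse for Left than X.
-- The theorem follows by applying the main lemma to G + H ≥D 0 and to the
-- conjugate of 0 ≥D G + H, since conjugation reverses ≥D.

open import Defs
open import Data.Empty using (⊥)
open import Data.List using (List; []; _∷_; _++_; map)
open import Data.List.Relation.Unary.All using (All; []; _∷_)
import Data.List.Relation.Unary.All as All
open import Data.List.Relation.Unary.Any using (here; there)
open import Data.List.Membership.Propositional using (_∈_)
open import Data.List.Membership.Propositional.Properties using (∈-map⁺; ∈-map⁻; ∈-++⁺ˡ; ∈-++⁺ʳ; ∈-++⁻)
open import Data.Nat using (ℕ; suc; _⊔_; _≤_; _<_; s≤s; _+_)
open import Data.Nat.Properties using (m≤m⊔n; m≤n⊔m; ≤-trans; <-trans; +-monoˡ-<; +-monoʳ-<; +-mono-<)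
open import Data.Nat.Induction using (<-wellFounded)
open import Induction.WellFounded using (Acc; acc)
open import Data.Product using (_×_; _,_; proj₁; proj₂; ∃-syntax)
open import Data.Sum using (_⊎_; inj₁; inj₂)
open import Relation.Nullary using (¬_)
open import Function using (case_of_)
open import Relation.Nullary.Negation using (DoubleNegation; Stable; ¬¬-map)
open import Relation.Binary.PropositionalEquality
  using (_≡_; _≢_; refl; sym; trans; cong; cong₂; subst; subst₂; module ≡-Reasoning)
open ≡-Reasoning

-- Outcomes. R < L is a two-element order, so a ≤ᴿ b just says "a = L implies b = L".

≤ᴿ-intro : ∀ {a b} → (a ≡ L → b ≡ L) → a ≤ᴿ b
≤ᴿ-intro {R} {R} _ = R≤R
≤ᴿ-intro {R} {L} _ = R≤L
≤ᴿ-intro {L} {L} _ = L≤L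
≤ᴿ-intro {L} {R} f with () ← f refl

≤ᴿ-elim : ∀ {a b} → a ≤ᴿ b → a ≡ L → b ≡ L
≤ᴿ-elim L≤L refl = refl

≢L⇒≡R : ∀ {r} → r ≢ L → r ≡ R
≢L⇒≡R {L} r≢L with () ← r≢L refl
≢L⇒≡R {R} _ = refl

≢R⇒≡L : ∀ {r} → r ≢ R → r ≡ L
≢R⇒≡L {L} _ = refl
≢R⇒≡L {R} r≢R with () ← r≢R refl

-- "r = L" is double-negation stable; this lets the (classical) arguments
-- about all dicots conclude statements about outcomes.
≡L-stable : ∀ r → Stable (r ≡ L)
≡L-stable L _ = refl
≡L-stable R ¬¬r≡L with () ← ¬¬r≡L (λ ())

flipR : Result → Result
flipR L = R
flipR R = L

flipR-antitone : ∀ {a b} → a ≤ᴿ b → flipR b ≤ᴿ flipR a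
flipR-antitone R≤R = L≤L
flipR-antitone R≤L = R≤L
flipR-antitone L≤L = R≤R

flipR-minR : ∀ a b → flipR (minR a b) ≡ maxR (flipR a) (flipR b)
flipR-minR L b = refl
flipR-minR R b = refl

flipR-maxR : ∀ a b → flipR (maxR a b) ≡ minR (flipR a) (flipR b)
flipR-maxR L b = refl
flipR-maxR R b = refl

appendL≡++ : ∀ xs ys → appendL xs ys ≡ xs ++ ys
appendL≡++ [] ys = refl
appendL≡++ (x ∷ xs) ys = cong (x ∷_) (appendL≡++ xs ys)

addR≡map : ∀ gs h → addR gs h ≡ map (_+G h) gs
addR≡map [] h = refl
addR≡map (g ∷ gs) h = cong ((g +G h) ∷_) (addR≡map gs h)

addL≡map : ∀ g hs → addL g hs ≡ map (g +G_) hs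
addL≡map g [] = refl
addL≡map g (h ∷ hs) = cong ((g +G h) ∷_) (addL≡map g hs)

conjList≡map : ∀ gs → conjList gs ≡ map conj gs
conjList≡map [] = refl
conjList≡map (g ∷ gs) = cong (conj g ∷_) (conjList≡map gs)

sumOpts : (Game → List Game) → Game → Game → List Game
sumOpts opts A B = map (_+G B) (opts A) ++ map (A +G_) (opts B)

leftOpts-+ : ∀ A B → leftOpts (A +G B) ≡ sumOpts leftOpts A B
leftOpts-+ A@(⟨ al ∣ ar ⟩) B@(⟨ bl ∣ br ⟩) =
  trans (appendL≡++ (addR al B) (addL A bl)) (cong₂ _++_ (addR≡map al B) (addL≡map A bl))

rightOpts-+ : ∀ A B → rightOpts (A +G B) ≡ sumOpts rightOpts A B
rightOpts-+ A@(⟨ al ∣ ar ⟩) B@(⟨ bl ∣ br ⟩) =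
  trans (appendL≡++ (addR ar B) (addL A br)) (cong₂ _++_ (addR≡map ar B) (addL≡map A br))

data SumOption (opts : Game → List Game) (A B : Game) : Game → Set where
  inFirst  : ∀ {a} → a ∈ opts A → SumOption opts A B (a +G B)
  inSecond : ∀ {b} → b ∈ opts B → SumOption opts A B (A +G b)

sumOpts⁻ : ∀ opts A B {x} → x ∈ sumOpts opts A B → SumOption opts A B x
sumOpts⁻ opts A B m with ∈-++⁻ (map (_+G B) (opts A)) m
... | inj₁ m₁ with ∈-map⁻ (_+G B) m₁
...   | a , am , refl = inFirst am
sumOpts⁻ opts A B m | inj₂ m₂ with ∈-map⁻ (A +G_) m₂
...   | b , bm , refl = inSecond bm

sumOpts⁺ : ∀ opts A B {x} → SumOption opts A B x → x ∈ sumOpts opts A B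
sumOpts⁺ opts A B (inFirst am) = ∈-++⁺ˡ (∈-map⁺ (_+G B) am)
sumOpts⁺ opts A B (inSecond bm) = ∈-++⁺ʳ (map (_+G B) (opts A)) (∈-map⁺ (A +G_) bm)

sumOpts-empty : ∀ opts A B → sumOpts opts A B ≡ [] → opts A ≡ [] × opts B ≡ []
sumOpts-empty opts A B = bothEmpty (opts A) (opts B)
  where
  bothEmpty : ∀ xs ys → map (_+G B) xs ++ map (A +G_) ys ≡ [] → xs ≡ [] × ys ≡ []
  bothEmpty [] [] _ = refl , refl

leftOpt-+⁻ : ∀ A B {x} → x ∈ leftOpts (A +G B) → SumOption leftOpts A B x
leftOpt-+⁻ A B m = sumOpts⁻ leftOpts A B (subst (_ ∈_) (leftOpts-+ A B) m)

rightOpt-+⁻ : ∀ A B {x} → x ∈ rightOpts (A +G B) → SumOption rightOpts A B x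
rightOpt-+⁻ A B m = sumOpts⁻ rightOpts A B (subst (_ ∈_) (rightOpts-+ A B) m)

leftOpt-+⁺ : ∀ A B {x} → SumOption leftOpts A B x → x ∈ leftOpts (A +G B)
leftOpt-+⁺ A B o = subst (_ ∈_) (sym (leftOpts-+ A B)) (sumOpts⁺ leftOpts A B o)

rightOpt-+⁺ : ∀ A B {x} → SumOption rightOpts A B x → x ∈ rightOpts (A +G B)
rightOpt-+⁺ A B o = subst (_ ∈_) (sym (rightOpts-+ A B)) (sumOpts⁺ rightOpts A B o)

leftOpts-+-empty : ∀ A B → leftOpts (A +G B) ≡ [] → leftOpts A ≡ [] × leftOpts B ≡ []
leftOpts-+-empty A B e = sumOpts-empty leftOpts A B (trans (sym (leftOpts-+ A B)) e)

rightOpts-+-empty : ∀ A B → rightOpts (A +G B) ≡ [] → rightOpts A ≡ [] × rightOpts B ≡ []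
rightOpts-+-empty A B e = sumOpts-empty rightOpts A B (trans (sym (rightOpts-+ A B)) e)

leftOpts-conj : ∀ G → leftOpts (conj G) ≡ map conj (rightOpts G)
leftOpts-conj ⟨ l ∣ r ⟩ = conjList≡map r

rightOpts-conj : ∀ G → rightOpts (conj G) ≡ map conj (leftOpts G)
rightOpts-conj ⟨ l ∣ r ⟩ = conjList≡map l

leftOpt-conj⁻ : ∀ G {x} → x ∈ leftOpts (conj G) → ∃[ a ] (a ∈ rightOpts G × x ≡ conj a)
leftOpt-conj⁻ G m = ∈-map⁻ conj (subst (_ ∈_) (leftOpts-conj G) m)

rightOpt-conj⁺ : ∀ G {a} → a ∈ leftOpts G → conj a ∈ rightOpts (conj G)
rightOpt-conj⁺ G am = subst (_ ∈_) (sym (rightOpts-conj G)) (∈-map⁺ conj am)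

conj-noLeft : ∀ G → leftOpts (conj G) ≡ [] → rightOpts G ≡ []
conj-noLeft ⟨ l ∣ [] ⟩ _ = refl

maxOR≡L⁺ : ∀ {x} g gs → x ∈ g ∷ gs → oR x ≡ L → maxOR g gs ≡ L
maxOR≡L⁺ g [] (here refl) e = e
maxOR≡L⁺ g (h ∷ hs) (here refl) e rewrite e = refl
maxOR≡L⁺ g (h ∷ hs) (there m) e with oR g
... | L = refl
... | R = maxOR≡L⁺ h hs m e

maxOR≡L⁻ : ∀ g gs → maxOR g gs ≡ L → ∃[ x ] (x ∈ g ∷ gs × oR x ≡ L)
maxOR≡L⁻ g [] e = g , here refl , e
maxOR≡L⁻ g (h ∷ hs) e with oR g in eg
... | L = g , here refl , eg
... | R with maxOR≡L⁻ h hs e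
...   | x , m , ex = x , there m , ex

minOL≡R⁺ : ∀ {x} g gs → x ∈ g ∷ gs → oL x ≡ R → minOL g gs ≡ R
minOL≡R⁺ g [] (here refl) e = e
minOL≡R⁺ g (h ∷ hs) (here refl) e rewrite e = refl
minOL≡R⁺ g (h ∷ hs) (there m) e with oL g
... | R = refl
... | L = minOL≡R⁺ h hs m e

minOL≡R⁻ : ∀ g gs → minOL g gs ≡ R → ∃[ x ] (x ∈ g ∷ gs × oL x ≡ R)
minOL≡R⁻ g [] e = g , here refl , e
minOL≡R⁻ g (h ∷ hs) e with oL g in eg
... | R = g , here refl , eg
... | L with minOL≡R⁻ h hs e
...   | x , m , ex = x , there m , ex

oL≡L⁺ : ∀ {x} G → x ∈ leftOpts G → oR x ≡ L → oL G ≡ L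
oL≡L⁺ ⟨ g ∷ gs ∣ r ⟩ m e = maxOR≡L⁺ g gs m e

oL≡L⁻ : ∀ G → oL G ≡ L → leftOpts G ≡ [] ⊎ ∃[ x ] (x ∈ leftOpts G × oR x ≡ L)
oL≡L⁻ ⟨ [] ∣ r ⟩ e = inj₁ refl
oL≡L⁻ ⟨ g ∷ gs ∣ r ⟩ e = inj₂ (maxOR≡L⁻ g gs e)

oR≡R⁺ : ∀ {x} G → x ∈ rightOpts G → oL x ≡ R → oR G ≡ R
oR≡R⁺ ⟨ l ∣ g ∷ gs ⟩ m e = minOL≡R⁺ g gs m e

oR≡R⁻ : ∀ G → oR G ≡ R → rightOpts G ≡ [] ⊎ ∃[ x ] (x ∈ rightOpts G × oL x ≡ R)
oR≡R⁻ ⟨ l ∣ [] ⟩ e = inj₁ refl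
oR≡R⁻ ⟨ l ∣ g ∷ gs ⟩ e = inj₂ (minOL≡R⁻ g gs e)

oL≡R⁺ : ∀ G → leftOpts G ≢ [] → (∀ {x} → x ∈ leftOpts G → oR x ≡ R) → oL G ≡ R
oL≡R⁺ G nonempty allLose = ≢L⇒≡R refute
  where
  refute : oL G ≢ L
  refute e with oL≡L⁻ G e
  ... | inj₁ empty = nonempty empty
  ... | inj₂ (x , m , ex) with () ← trans (sym ex) (allLose m)

oR≡L⁺ : ∀ G → rightOpts G ≢ [] → (∀ {x} → x ∈ rightOpts G → oL x ≡ L) → oR G ≡ L
oR≡L⁺ G nonempty allWin = ≢R⇒≡L refute
  where
  refute : oR G ≢ R
  refute e with oR≡R⁻ G e
  ... | inj₁ empty = nonempty empty
  ... | inj₂ (x , m , ex) with () ← trans (sym (allWin m)) ex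

oR≡L⇒allWin : ∀ {x} G → oR G ≡ L → x ∈ rightOpts G → oL x ≡ L
oR≡L⇒allWin G e m = ≢R⇒≡L λ ex → case trans (sym e) (oR≡R⁺ G m ex) of λ ()

mutual
  +-identityˡ : ∀ G → zeroG +G G ≡ G
  +-identityˡ ⟨ l ∣ r ⟩ = cong₂ ⟨_∣_⟩ (addL-zero l) (addL-zero r)

  addL-zero : ∀ gs → addL zeroG gs ≡ gs
  addL-zero [] = refl
  addL-zero (g ∷ gs) = cong₂ _∷_ (+-identityˡ g) (addL-zero gs)

mutual
  +-identityʳ : ∀ G → G +G zeroG ≡ G
  +-identityʳ ⟨ l ∣ r ⟩ = cong₂ ⟨_∣_⟩ (addR-zero l) (addR-zero r)

  addR-zero : ∀ gs → appendL (addR gs zeroG) [] ≡ gs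
  addR-zero [] = refl
  addR-zero (g ∷ gs) = cong₂ _∷_ (+-identityʳ g) (addR-zero gs)

mutual
  conj-involutive : ∀ G → conj (conj G) ≡ G
  conj-involutive ⟨ l ∣ r ⟩ = cong₂ ⟨_∣_⟩ (conjList-involutive l) (conjList-involutive r)

  conjList-involutive : ∀ gs → conjList (conjList gs) ≡ gs
  conjList-involutive [] = refl
  conjList-involutive (g ∷ gs) = cong₂ _∷_ (conj-involutive g) (conjList-involutive gs)

mutual
  conj-+ : ∀ A B → conj (A +G B) ≡ conj A +G conj B
  conj-+ A@(⟨ al ∣ ar ⟩) B@(⟨ bl ∣ br ⟩) =
    cong₂ ⟨_∣_⟩ (conj-sumOpts ar B A br) (conj-sumOpts al B A bl)

  conj-sumOpts : ∀ as B A bs →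
    conjList (appendL (addR as B) (addL A bs))
      ≡ appendL (addR (conjList as) (conj B)) (addL (conj A) (conjList bs))
  conj-sumOpts [] B A bs = conj-addL A bs
  conj-sumOpts (a ∷ as) B A bs = cong₂ _∷_ (conj-+ a B) (conj-sumOpts as B A bs)

  conj-addL : ∀ A bs → conjList (addL A bs) ≡ addL (conj A) (conjList bs)
  conj-addL A [] = refl
  conj-addL A (b ∷ bs) = cong₂ _∷_ (conj-+ A b) (conj-addL A bs)

mutual
  oL-conj : ∀ G → oL (conj G) ≡ flipR (oR G)
  oL-conj ⟨ l ∣ [] ⟩ = refl
  oL-conj ⟨ l ∣ g ∷ gs ⟩ = maxOR-conj g gs

  oR-conj : ∀ G → oR (conj G) ≡ flipR (oL G)
  oR-conj ⟨ [] ∣ r ⟩ = refl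
  oR-conj ⟨ g ∷ gs ∣ r ⟩ = minOL-conj g gs

  maxOR-conj : ∀ g gs → maxOR (conj g) (conjList gs) ≡ flipR (minOL g gs)
  maxOR-conj g [] = oR-conj g
  maxOR-conj g (h ∷ hs) =
    trans (cong₂ maxR (oR-conj g) (maxOR-conj h hs)) (sym (flipR-minR (oL g) (minOL h hs)))

  minOL-conj : ∀ g gs → minOL (conj g) (conjList gs) ≡ flipR (maxOR g gs)
  minOL-conj g [] = oL-conj g
  minOL-conj g (h ∷ hs) =
    trans (cong₂ minR (oL-conj g) (minOL-conj h hs)) (sym (flipR-maxR (oR g) (maxOR h hs)))

dicot-leftOpts : ∀ {G} → IsDicot G → All IsDicot (leftOpts G)
dicot-leftOpts dicot-zero = []
dicot-leftOpts (dicot-cons _ _ _ _ dl _) = dl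

dicot-leftOpt : ∀ {G x} → IsDicot G → x ∈ leftOpts G → IsDicot x
dicot-leftOpt dG = All.lookup (dicot-leftOpts dG)

dicot-rightOpt : ∀ {G x} → IsDicot G → x ∈ rightOpts G → IsDicot x
dicot-rightOpt (dicot-cons _ _ _ _ _ dr) m = All.lookup dr m

dicot-noLeft : ∀ {G} → IsDicot G → leftOpts G ≡ [] → G ≡ zeroG
dicot-noLeft dicot-zero _ = refl

dicot-noRight : ∀ {G} → IsDicot G → rightOpts G ≡ [] → G ≡ zeroG
dicot-noRight dicot-zero _ = refl

mutual
  dicot-conj : ∀ {G} → IsDicot G → IsDicot (conj G)
  dicot-conj dicot-zero = dicot-zero
  dicot-conj (dicot-cons _ _ _ _ dl dr) = dicot-cons _ _ _ _ (dicot-conjList dr) (dicot-conjList dl)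

  dicot-conjList : ∀ {gs} → All IsDicot gs → All IsDicot (conjList gs)
  dicot-conjList [] = []
  dicot-conjList (d ∷ ds) = dicot-conj d ∷ dicot-conjList ds

mutual
  dicot-+ : ∀ {A B} → IsDicot A → IsDicot B → IsDicot (A +G B)
  dicot-+ dicot-zero dicot-zero = dicot-zero
  dicot-+ dicot-zero (dicot-cons _ _ _ _ dl dr) =
    dicot-cons _ _ _ _ (dicot-addL dicot-zero dl) (dicot-addL dicot-zero dr)
  dicot-+ (dicot-cons _ _ _ _ dl dr) dicot-zero =
    dicot-cons _ _ _ _ (dicot-appendL (dicot-addR dl dicot-zero) [])
                       (dicot-appendL (dicot-addR dr dicot-zero) [])
  dicot-+ dA@(dicot-cons _ _ _ _ al ar) dB@(dicot-cons _ _ _ _ bl br) =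
    dicot-cons _ _ _ _ (dicot-appendL (dicot-addR al dB) (dicot-addL dA bl))
                       (dicot-appendL (dicot-addR ar dB) (dicot-addL dA br))

  dicot-addR : ∀ {gs B} → All IsDicot gs → IsDicot B → All IsDicot (addR gs B)
  dicot-addR [] dB = []
  dicot-addR (d ∷ ds) dB = dicot-+ d dB ∷ dicot-addR ds dB

  dicot-addL : ∀ {A gs} → IsDicot A → All IsDicot gs → All IsDicot (addL A gs)
  dicot-addL dA [] = []
  dicot-addL dA (d ∷ ds) = dicot-+ dA d ∷ dicot-addL dA ds

  dicot-appendL : ∀ {xs ys} → All IsDicot xs → All IsDicot ys → All IsDicot (appendL xs ys)
  dicot-appendL [] dys = dys
  dicot-appendL (d ∷ dxs) dys = d ∷ dicot-appendL dxs dys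

mutual
  height : Game → ℕ
  height ⟨ l ∣ r ⟩ = suc (heightList l ⊔ heightList r)

  heightList : List Game → ℕ
  heightList [] = 0
  heightList (g ∷ gs) = height g ⊔ heightList gs

height-∈ : ∀ {x} gs → x ∈ gs → height x ≤ heightList gs
height-∈ (g ∷ gs) (here refl) = m≤m⊔n (height g) (heightList gs)
height-∈ (g ∷ gs) (there m) = ≤-trans (height-∈ gs m) (m≤n⊔m (height g) (heightList gs))

height-leftOpt : ∀ {x} G → x ∈ leftOpts G → height x < height G
height-leftOpt ⟨ l ∣ r ⟩ m = s≤s (≤-trans (height-∈ l m) (m≤m⊔n (heightList l) (heightList r)))

height-rightOpt : ∀ {x} G → x ∈ rightOpts G → height x < height G
height-rightOpt ⟨ l ∣ r ⟩ m = s≤s (≤-trans (height-∈ r m) (m≤n⊔m (heightList l) (heightList r)))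

-- The adjoint G° of misère theory: 0° = * and G° = { (G^R)° | (G^L)° } otherwise.
-- (Only its values on dicots matter.)
star : Game
star = ⟨ zeroG ∷ [] ∣ zeroG ∷ [] ⟩

mutual
  adjoint : Game → Game
  adjoint ⟨ [] ∣ [] ⟩ = star
  adjoint ⟨ l ∣ r ⟩ = ⟨ adjointList r ∣ adjointList l ⟩

  adjointList : List Game → List Game
  adjointList [] = []
  adjointList (g ∷ gs) = adjoint g ∷ adjointList gs

∈-adjointList⁺ : ∀ {x gs} → x ∈ gs → adjoint x ∈ adjointList gs
∈-adjointList⁺ (here refl) = here refl
∈-adjointList⁺ (there m) = there (∈-adjointList⁺ m)

∈-adjointList⁻ : ∀ {y} gs → y ∈ adjointList gs → ∃[ x ] (x ∈ gs × y ≡ adjoint x)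
∈-adjointList⁻ (g ∷ gs) (here refl) = g , here refl , refl
∈-adjointList⁻ (g ∷ gs) (there m) with ∈-adjointList⁻ gs m
... | x , xm , refl = x , there xm , refl

mutual
  dicot-adjoint : ∀ {G} → IsDicot G → IsDicot (adjoint G)
  dicot-adjoint dicot-zero = dicot-cons _ _ _ _ (dicot-zero ∷ []) (dicot-zero ∷ [])
  dicot-adjoint (dicot-cons _ _ _ _ dl dr) =
    dicot-cons _ _ _ _ (dicot-adjointList dr) (dicot-adjointList dl)

  dicot-adjointList : ∀ {gs} → All IsDicot gs → All IsDicot (adjointList gs)
  dicot-adjointList [] = []
  dicot-adjointList (d ∷ ds) = dicot-adjoint d ∷ dicot-adjointList ds

IsP : Game → Set
IsP G = (oL G ≡ R) × (oR G ≡ L)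

AdjointP : Game → Set
AdjointP g = IsP (g +G adjoint g)

-- For a dicot G, G + G° is a P-position: every move in one component is
-- answered by the mirror move, reaching some G' + G'° (a P-position by induction).
-- This is where the dicot hypothesis matters: G has moves for both or neither player.
adjoint-P-step : ∀ gl gls gr grs → All AdjointP (gl ∷ gls) → All AdjointP (gr ∷ grs) →
  AdjointP ⟨ gl ∷ gls ∣ gr ∷ grs ⟩
adjoint-P-step gl gls gr grs IHl IHr = leftLoses , rightLoses
  where
  G G° : Game
  G = ⟨ gl ∷ gls ∣ gr ∷ grs ⟩
  G° = adjoint G

  leftLoses : oL (G +G G°) ≡ R
  leftLoses = oL≡R⁺ (G +G G°) (λ ()) answer
    where
    answer : ∀ {x} → x ∈ leftOpts (G +G G°) → oR x ≡ R
    answer m with leftOpt-+⁻ G G° m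
    ... | inFirst {a} am =
      oR≡R⁺ (a +G G°) (rightOpt-+⁺ a G° (inSecond (∈-adjointList⁺ am))) (proj₁ (All.lookup IHl am))
    ... | inSecond ym with ∈-adjointList⁻ (gr ∷ grs) ym
    ...   | c , cm , refl =
      oR≡R⁺ (G +G adjoint c) (rightOpt-+⁺ G (adjoint c) (inFirst cm)) (proj₁ (All.lookup IHr cm))

  rightLoses : oR (G +G G°) ≡ L
  rightLoses = oR≡L⁺ (G +G G°) (λ ()) answer
    where
    answer : ∀ {x} → x ∈ rightOpts (G +G G°) → oL x ≡ L
    answer m with rightOpt-+⁻ G G° m
    ... | inFirst {c} cm =
      oL≡L⁺ (c +G G°) (leftOpt-+⁺ c G° (inSecond (∈-adjointList⁺ cm))) (proj₂ (All.lookup IHr cm))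
    ... | inSecond ym with ∈-adjointList⁻ (gl ∷ gls) ym
    ...   | a , am , refl =
      oL≡L⁺ (G +G adjoint a) (leftOpt-+⁺ G (adjoint a) (inFirst am)) (proj₂ (All.lookup IHl am))

mutual
  adjoint-P : ∀ {G} → IsDicot G → AdjointP G
  adjoint-P dicot-zero = refl , refl
  adjoint-P (dicot-cons gl gls gr grs dl dr) =
    adjoint-P-step gl gls gr grs (adjoint-PList dl) (adjoint-PList dr)

  adjoint-PList : ∀ {gs} → All IsDicot gs → All AdjointP gs
  adjoint-PList [] = []
  adjoint-PList (d ∷ ds) = adjoint-P d ∷ adjoint-PList ds

-- The answers
-- are only needed up to double negation, since outcomes are stable.
LeftAnswer : Game → Game → Set
LeftAnswer A b = (∃[ a ] (a ∈ leftOpts A × a ≥D b)) ⊎ (∃[ c ] (c ∈ rightOpts b × A ≥D c))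

RightAnswer : Game → Game → Set
RightAnswer a B = (∃[ b ] (b ∈ rightOpts B × a ≥D b)) ⊎ (∃[ c ] (c ∈ leftOpts a × c ≥D B))

record Maintains (A B : Game) : Set where
  field
    answerLeft : ∀ {b} → b ∈ leftOpts B → DoubleNegation (LeftAnswer A b)
    answerRight : ∀ {a} → a ∈ rightOpts A → DoubleNegation (RightAnswer a B)
    leftEnd : leftOpts B ≡ [] → oL A ≡ L
    rightEnd : rightOpts A ≡ [] → oR B ≡ R

Dominates : Game → Game → Game → Set
Dominates A B X = (oL (B +G X) ≡ L → oL (A +G X) ≡ L) × (oR (B +G X) ≡ L → oR (A +G X) ≡ L)

module _ {A B : Game} (M : Maintains A B) where
  open Maintains M

  -- One step of the induction on the dicot X: Left copies the strategy that
  -- wins B + X in A + X, using the answers whenever it calls for a move in B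
  -- (or Right moves in A), and the induction hypothesis for moves in X.
  maintains-leftFirst : ∀ {X} → IsDicot X → All (Dominates A B) (leftOpts X) →
    oL (B +G X) ≡ L → oL (A +G X) ≡ L
  maintains-leftFirst {X} dX IHl e with oL≡L⁻ (B +G X) e
  ... | inj₁ noMove with leftOpts-+-empty B X noMove
  ...   | noLeftB , noLeftX with refl ← dicot-noLeft dX noLeftX =
    subst (λ G → oL G ≡ L) (sym (+-identityʳ A)) (leftEnd noLeftB)
  maintains-leftFirst {X} dX IHl e | inj₂ (y , ym , win) with leftOpt-+⁻ B X ym
  ... | inSecond xm =
    oL≡L⁺ (A +G X) (leftOpt-+⁺ A X (inSecond xm)) (proj₂ (All.lookup IHl xm) win)
  ... | inFirst {b} bm = ≡L-stable _ (¬¬-map answer (answerLeft bm))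
    where
    answer : LeftAnswer A b → oL (A +G X) ≡ L
    answer (inj₁ (a , am , a≥b)) =
      oL≡L⁺ (A +G X) (leftOpt-+⁺ A X (inFirst am)) (≤ᴿ-elim (proj₂ (a≥b X dX)) win)
    answer (inj₂ (c , cm , A≥c)) =
      ≤ᴿ-elim (proj₁ (A≥c X dX)) (oR≡L⇒allWin (b +G X) win (rightOpt-+⁺ b X (inFirst cm)))

  maintains-rightFirst : ∀ {X} → IsDicot X → All (Dominates A B) (rightOpts X) →
    oR (B +G X) ≡ L → oR (A +G X) ≡ L
  maintains-rightFirst {X} dX IHr e = oR≡L⁺ (A +G X) hasMove answer
    where
    hasMove : rightOpts (A +G X) ≢ []
    hasMove noMove with rightOpts-+-empty A X noMove
    ... | noRightA , noRightX with refl ← dicot-noRight dX noRightX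
      with () ← trans (sym e) (subst (λ G → oR G ≡ R) (sym (+-identityʳ B)) (rightEnd noRightA))

    answer : ∀ {x} → x ∈ rightOpts (A +G X) → oL x ≡ L
    answer m with rightOpt-+⁻ A X m
    ... | inSecond xm =
      proj₁ (All.lookup IHr xm) (oR≡L⇒allWin (B +G X) e (rightOpt-+⁺ B X (inSecond xm)))
    ... | inFirst {a} am = ≡L-stable _ (¬¬-map reply (answerRight am))
      where
      reply : RightAnswer a B → oL (a +G X) ≡ L
      reply (inj₁ (b , bm , a≥b)) =
        ≤ᴿ-elim (proj₁ (a≥b X dX)) (oR≡L⇒allWin (B +G X) e (rightOpt-+⁺ B X (inFirst bm)))
      reply (inj₂ (c , cm , c≥B)) =
        oL≡L⁺ (a +G X) (leftOpt-+⁺ a X (inFirst cm)) (≤ᴿ-elim (proj₂ (c≥B X dX)) e)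

  maintains-step : ∀ {X} → IsDicot X → All (Dominates A B) (leftOpts X) →
    All (Dominates A B) (rightOpts X) → Dominates A B X
  maintains-step dX IHl IHr = maintains-leftFirst dX IHl , maintains-rightFirst dX IHr

  mutual
    maintains-dominates : ∀ {X} → IsDicot X → Dominates A B X
    maintains-dominates dicot-zero = maintains-step dicot-zero [] []
    maintains-dominates dX@(dicot-cons _ _ _ _ dl dr) =
      maintains-step dX (maintains-dominatesList dl) (maintains-dominatesList dr)

    maintains-dominatesList : ∀ {xs} → All IsDicot xs → All (Dominates A B) xs
    maintains-dominatesList [] = []
    maintains-dominatesList (d ∷ ds) = maintains-dominates d ∷ maintains-dominatesList ds

  maintains⇒≥D : A ≥D B
  maintains⇒≥D X dX with maintains-dominates dX
  ... | domL , domR = ≤ᴿ-intro domL , ≤ᴿ-intro domR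

≥D0⇒L : ∀ C {X} → C ≥D zeroG → IsDicot X → oL X ≡ L → oL (C +G X) ≡ L
≥D0⇒L C {X} C≥0 dX e = ≤ᴿ-elim (proj₁ (C≥0 X dX)) (subst (λ G → oL G ≡ L) (sym (+-identityˡ X)) e)

≥D0⇒R : ∀ C {X} → C ≥D zeroG → IsDicot X → oR X ≡ L → oR (C +G X) ≡ L
≥D0⇒R C {X} C≥0 dX e = ≤ᴿ-elim (proj₂ (C≥0 X dX)) (subst (λ G → oR G ≡ L) (sym (+-identityˡ X)) e)

≥D0⇒oL : ∀ C → C ≥D zeroG → oL C ≡ L
≥D0⇒oL C C≥0 = subst (λ G → oL G ≡ L) (+-identityʳ C) (≥D0⇒L C C≥0 dicot-zero refl)

Spoiler : Game → Set
Spoiler C = ∃[ Z ] (IsDicot Z × oL Z ≡ L × oL (C +G Z) ≡ R)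

-- A failure of C ≥D 0 with Right moving first yields a spoiler too:
-- if oR X = L but oR (C + X) = R, take Z = { X | 0, (C^L)° }.  Left's move
-- from C + Z to C + X loses, and C^L + Z loses to Right's reply C^L + (C^L)°.
spoiler-fromRight : ∀ {C X} → IsDicot C → IsDicot X → oR X ≡ L → oR (C +G X) ≡ R → Spoiler C
spoiler-fromRight {C} {X} dC dX oRX oRCX = Z , dZ , oL≡L⁺ Z (here refl) oRX , leftLoses
  where
  Z : Game
  Z = ⟨ X ∷ [] ∣ zeroG ∷ adjointList (leftOpts C) ⟩

  dZ : IsDicot Z
  dZ = dicot-cons _ _ _ _ (dX ∷ []) (dicot-zero ∷ dicot-adjointList (dicot-leftOpts dC))

  leftLoses : oL (C +G Z) ≡ R
  leftLoses = oL≡R⁺ (C +G Z) (λ noMove → case subst ((C +G X) ∈_) noMove toX of λ ()) answer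
    where
    toX : (C +G X) ∈ leftOpts (C +G Z)
    toX = leftOpt-+⁺ C Z (inSecond (here refl))

    answer : ∀ {x} → x ∈ leftOpts (C +G Z) → oR x ≡ R
    answer m with leftOpt-+⁻ C Z m
    ... | inSecond (here refl) = oRCX
    ... | inFirst {a} am =
      oR≡R⁺ (a +G Z) (rightOpt-+⁺ a Z (inSecond (there (∈-adjointList⁺ am))))
        (proj₁ (adjoint-P (dicot-leftOpt dC am)))

noSpoiler⇒≥D0 : ∀ {C} → IsDicot C → ¬ Spoiler C → C ≥D zeroG
noSpoiler⇒≥D0 {C} dC noSpoiler X dX rewrite +-identityˡ X =
  ≤ᴿ-intro (λ oLX → ≢R⇒≡L λ oLCX → noSpoiler (X , dX , oLX , oLCX)) ,
  ≤ᴿ-intro (λ oRX → ≢R⇒≡L λ oRCX → noSpoiler (spoiler-fromRight dC dX oRX oRCX))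

spoilers : ∀ {gs} → All Spoiler gs → List Game
spoilers [] = []
spoilers ((Z , _) ∷ sps) = Z ∷ spoilers sps

spoilers-valid : ∀ {gs} (sps : All Spoiler gs) {Z} → Z ∈ spoilers sps → IsDicot Z × oL Z ≡ L
spoilers-valid ((_ , dZ , oLZ , _) ∷ sps) (here refl) = dZ , oLZ
spoilers-valid (_ ∷ sps) (there m) = spoilers-valid sps m

spoilers-spoil : ∀ {gs} (sps : All Spoiler gs) {g} → g ∈ gs →
  ∃[ Z ] (Z ∈ spoilers sps × oL (g +G Z) ≡ R)
spoilers-spoil ((Z , _ , _ , spoils) ∷ sps) (here refl) = Z , here refl , spoils
spoilers-spoil (_ ∷ sps) (there m) with spoilers-spoil sps m
... | Z , Zm , spoils = Z , there Zm , spoils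

-- If every left option of a right option A^R of A has a spoiler Zᵢ, then A ≱D 0.
-- Take X = { {0 | (A^R)°} | 0, Z₁, …, Zₖ }: Left wins X with Right moving first,
-- but Right wins A + X by moving to A^R + X, where each Left move loses:
-- A^{RL}ᵢ + X to the reply A^{RL}ᵢ + Zᵢ, and A^R + {0 | (A^R)°} to A^R + (A^R)°.
spoiled-rightOpt : ∀ {A AR} → IsDicot A → A ≥D zeroG → AR ∈ rightOpts A →
  All Spoiler (leftOpts AR) → ⊥
spoiled-rightOpt {A} {AR} dA A≥0 ARm sps = case trans (sym (≥D0⇒R A A≥0 dX oRX)) oRAX of λ ()
  where
  dAR : IsDicot AR
  dAR = dicot-rightOpt dA ARm

  W X : Game
  W = ⟨ zeroG ∷ [] ∣ adjoint AR ∷ [] ⟩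
  X = ⟨ W ∷ [] ∣ zeroG ∷ spoilers sps ⟩

  dX : IsDicot X
  dX = dicot-cons _ _ _ _ (dicot-cons _ _ _ _ (dicot-zero ∷ []) (dicot-adjoint dAR ∷ []) ∷ [])
         (dicot-zero ∷ All.tabulate (λ Zm → proj₁ (spoilers-valid sps Zm)))

  oRX : oR X ≡ L
  oRX = oR≡L⁺ X (λ ()) λ { (here refl) → refl ; (there Zm) → proj₂ (spoilers-valid sps Zm) }

  leftLosesAR : oL (AR +G X) ≡ R
  leftLosesAR = oL≡R⁺ (AR +G X) (λ noMove → case subst ((AR +G W) ∈_) noMove toW of λ ()) answer
    where
    toW : (AR +G W) ∈ leftOpts (AR +G X)
    toW = leftOpt-+⁺ AR X (inSecond (here refl))

    answer : ∀ {x} → x ∈ leftOpts (AR +G X) → oR x ≡ R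
    answer m with leftOpt-+⁻ AR X m
    ... | inSecond (here refl) =
      oR≡R⁺ (AR +G W) (rightOpt-+⁺ AR W (inSecond (here refl))) (proj₁ (adjoint-P dAR))
    ... | inFirst {c} cm with spoilers-spoil sps cm
    ...   | Z , Zm , spoils = oR≡R⁺ (c +G X) (rightOpt-+⁺ c X (inSecond (there Zm))) spoils

  oRAX : oR (A +G X) ≡ R
  oRAX = oR≡R⁺ (A +G X) (rightOpt-+⁺ A X (inFirst ARm)) leftLosesAR

¬¬-All : ∀ {P : Game → Set} gs → (∀ {x} → x ∈ gs → DoubleNegation (P x)) →
  DoubleNegation (All P gs)
¬¬-All [] _ k = k []
¬¬-All (g ∷ gs) ¬¬P k =
  ¬¬P (here refl) λ Pg → ¬¬-All gs (λ m → ¬¬P (there m)) (λ Pgs → k (Pg ∷ Pgs))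

rightOpt-reply : ∀ {A AR} → IsDicot A → A ≥D zeroG → AR ∈ rightOpts A →
  DoubleNegation (∃[ Y ] (Y ∈ leftOpts AR × Y ≥D zeroG))
rightOpt-reply {A} {AR} dA A≥0 ARm noReply =
  ¬¬-All (leftOpts AR) spoiled (spoiled-rightOpt dA A≥0 ARm)
  where
  spoiled : ∀ {Y} → Y ∈ leftOpts AR → DoubleNegation (Spoiler Y)
  spoiled Ym noSpoiler =
    noReply (_ , Ym , noSpoiler⇒≥D0 (dicot-leftOpt (dicot-rightOpt dA ARm) Ym) noSpoiler)

SumLemmaBelow : Game → Game → Set
SumLemmaBelow A B = ∀ {A' B'} → height A' + height B' < height A + height B →
  IsDicot A' → IsDicot B' → (A' +G B') ≥D zeroG → B' ≥D conj A'

-- A Left move conj A^R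
-- in Ā and a Right move B^R in B correspond to the Right moves A^R + B and
-- A + B^R of A + B; rightOpt-reply provides a left option of these that is
-- ≥D 0, and the induction hypothesis turns it into the required answer.
sum≥D0-maintains : ∀ {A B} → SumLemmaBelow A B → IsDicot A → IsDicot B → (A +G B) ≥D zeroG →
  Maintains B (conj A)
sum≥D0-maintains {A} {B} IH dA dB A+B≥0 =
  record { answerLeft = answerLeft ; answerRight = answerRight
         ; leftEnd = leftEnd ; rightEnd = rightEnd }
  where
  dA+B : IsDicot (A +G B)
  dA+B = dicot-+ dA dB

  answerLeft : ∀ {x} → x ∈ leftOpts (conj A) → DoubleNegation (LeftAnswer B x)
  answerLeft xm with leftOpt-conj⁻ A xm
  ... | a , am , refl = ¬¬-map answer (rightOpt-reply dA+B A+B≥0 (rightOpt-+⁺ A B (inFirst am)))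
    where
    da : IsDicot a
    da = dicot-rightOpt dA am
    answer : ∃[ Y ] (Y ∈ leftOpts (a +G B) × Y ≥D zeroG) → LeftAnswer B (conj a)
    answer (Y , Ym , Y≥0) with leftOpt-+⁻ a B Ym
    ... | inFirst {a'} a'm = inj₂ (conj a' , rightOpt-conj⁺ a a'm ,
      IH (+-monoˡ-< (height B) (<-trans (height-leftOpt a a'm) (height-rightOpt A am)))
         (dicot-leftOpt da a'm) dB Y≥0)
    ... | inSecond {b} bm = inj₁ (b , bm ,
      IH (+-mono-< (height-rightOpt A am) (height-leftOpt B bm)) da (dicot-leftOpt dB bm) Y≥0)

  answerRight : ∀ {b} → b ∈ rightOpts B → DoubleNegation (RightAnswer b (conj A))
  answerRight {b} bm = ¬¬-map answer (rightOpt-reply dA+B A+B≥0 (rightOpt-+⁺ A B (inSecond bm)))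
    where
    db : IsDicot b
    db = dicot-rightOpt dB bm
    answer : ∃[ Y ] (Y ∈ leftOpts (A +G b) × Y ≥D zeroG) → RightAnswer b (conj A)
    answer (Y , Ym , Y≥0) with leftOpt-+⁻ A b Ym
    ... | inFirst {a} am = inj₁ (conj a , rightOpt-conj⁺ A am ,
      IH (+-mono-< (height-leftOpt A am) (height-rightOpt B bm)) (dicot-leftOpt dA am) db Y≥0)
    ... | inSecond {c} cm = inj₂ (c , cm ,
      IH (+-monoʳ-< (height A) (<-trans (height-leftOpt b cm) (height-rightOpt B bm)))
         dA (dicot-leftOpt db cm) Y≥0)

  -- If Ā has no Left move then A = 0, so B ≥D 0 and Left wins B moving first.
  leftEnd : leftOpts (conj A) ≡ [] → oL B ≡ L
  leftEnd noLeft with refl ← dicot-noRight dA (conj-noLeft A noLeft) =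
    subst (λ G → oL G ≡ L) (+-identityˡ B) (≥D0⇒oL (zeroG +G B) A+B≥0)

  -- If B has no Right move then B = 0, so A ≥D 0 and Right loses Ā moving first.
  rightEnd : rightOpts B ≡ [] → oR (conj A) ≡ R
  rightEnd noRight with refl ← dicot-noRight dB noRight =
    trans (oR-conj A) (cong flipR oLA)
    where
    oLA : oL A ≡ L
    oLA = subst (λ G → oL G ≡ L) (+-identityʳ A) (≥D0⇒oL (A +G zeroG) A+B≥0)

sum≥D0⇒≥D-conj : ∀ {A B} → IsDicot A → IsDicot B → (A +G B) ≥D zeroG → B ≥D conj A
sum≥D0⇒≥D-conj {A} {B} = go (<-wellFounded (height A + height B))
  where
  go : ∀ {A B} → Acc _<_ (height A + height B) → IsDicot A → IsDicot B →
    (A +G B) ≥D zeroG → B ≥D conj A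
  go (acc lower) dA dB A+B≥0 = maintains⇒≥D (sum≥D0-maintains (λ lt → go (lower lt)) dA dB A+B≥0)

oL-conj-+ : ∀ G X → oL (conj G +G X) ≡ flipR (oR (G +G conj X))
oL-conj-+ G X = begin
  oL (conj G +G X)                     ≡⟨ cong (λ Y → oL (conj G +G Y)) (sym (conj-involutive X)) ⟩
  oL (conj G +G conj (conj X))         ≡⟨ cong oL (sym (conj-+ G (conj X))) ⟩
  oL (conj (G +G conj X))              ≡⟨ oL-conj (G +G conj X) ⟩
  flipR (oR (G +G conj X))             ∎

oR-conj-+ : ∀ G X → oR (conj G +G X) ≡ flipR (oL (G +G conj X))
oR-conj-+ G X = begin
  oR (conj G +G X)                     ≡⟨ cong (λ Y → oR (conj G +G Y)) (sym (conj-involutive X)) ⟩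
  oR (conj G +G conj (conj X))         ≡⟨ cong oR (sym (conj-+ G (conj X))) ⟩
  oR (conj (G +G conj X))              ≡⟨ oR-conj (G +G conj X) ⟩
  flipR (oL (G +G conj X))             ∎

-- Conjugation reverses ≥D (compare against the conjugated dicot X̄).
conj-antitone : ∀ A B → A ≥D B → conj B ≥D conj A
conj-antitone A B A≥B X dX with A≥B (conj X) (dicot-conj dX)
... | leftCmp , rightCmp =
  subst₂ _≤ᴿ_ (sym (oL-conj-+ A X)) (sym (oL-conj-+ B X)) (flipR-antitone rightCmp) ,
  subst₂ _≤ᴿ_ (sym (oR-conj-+ A X)) (sym (oR-conj-+ B X)) (flipR-antitone leftCmp)

-- H ≥D Ḡ is the main lemma; for Ḡ ≥D H, conjugate 0 ≥D G + H to Ḡ + H̄ ≥D 0,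
-- apply the main lemma to get H̄ ≥D G, and conjugate back.
mainTheorem15 : (G H : Game) → IsDicot G → IsDicot H →
    (G +G H) ≡D zeroG → H ≡D conj G
mainTheorem15 G H dG dH (G+H≥0 , 0≥G+H) = H≥Ḡ , Ḡ≥H
  where
  H≥Ḡ : H ≥D conj G
  H≥Ḡ = sum≥D0⇒≥D-conj dG dH G+H≥0

  Ḡ+H̄≥0 : (conj G +G conj H) ≥D zeroG
  Ḡ+H̄≥0 = subst (_≥D zeroG) (conj-+ G H) (conj-antitone zeroG (G +G H) 0≥G+H)

  H̄≥G : conj H ≥D G
  H̄≥G = subst (conj H ≥D_) (conj-involutive G)
          (sum≥D0⇒≥D-conj (dicot-conj dG) (dicot-conj dH) Ḡ+H̄≥0)

  Ḡ≥H : conj G ≥D H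
  Ḡ≥H = subst (conj G ≥D_) (conj-involutive H) (conj-antitone (conj H) G H̄≥G)
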